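{- Let $n,r,d\geq 1$ be integers. For every family $\mathcal{F}\subset \binom{[n]}{r}^d$ there is a monotone family $\mathcal{F}_0\subset \binom{[n]}{r}^d$ with $|\mathcal{F}_0|=|\mathcal{F}|$ and $|\partial \mathcal{F}_0|\leq |\partial \mathcal{F}|$.
   Context: $[n]=\{1,\dotsc,n\}$ with its usual ordering, and $\binom{[n]}{r}$ is the family of $r$-element subsets of $[n]$. Colexicographic order on $\binom{[n]}{r}$: $A$ precedes $B$ if the largest element of the symmetric difference $(A\cup B)\setminus(A\cap B)$ lies in $B$. The shadow of $\mathcal{F}\subset\binom{[n]}{r}^d$ is $\partial\mathcal{F}=\{(S_1\setminus\{x_1\},\dotsc,S_d\setminus\{x_d\}) : (S_1,\dotsc,S_d)\in\mathcal{F},\ x_i\in S_i\text{ for all }i\}$. A $1$-dimensional section of $\mathcal{F}$ is obtained by fixing $d-1$ of the coordinates: for an index $j$ and fixed sets $S_i\in\binom{[n]}{r}$ ($i\neq j$), it is the family of those $T\in\binom{[n]}{r}$ such that the $d$-tuple with $T$ in coordinate $j$ and $S_i$ in coordinate $i\neq j$ lies in $\mathcal{F}$. A family $\mathcal{F}\subset\binom{[n]}{r}^d$ is monotone if every $1$-dimensional section of it is an initial segment of the colexicographic order on $\binom{[n]}{r}$. -}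

module Defs where

open import Data.Bool using (Bool; true; false; _∧_; T; T?)
open import Data.Nat using (ℕ; zero; suc)
open import Data.Fin using (Fin) renaming (_<_ to _<ᶠ_)
open import Data.Fin.Subset using (Subset; ∣_∣; _-_)
open import Data.List using (List; []; _∷_; concatMap; map; length; filter; allFin)
open import Data.Bool.ListAction using (any)
open import Data.Vec using (Vec; []; _∷_; lookup; _[_]≔_; zipWith; foldr)
import Data.Vec.Properties as VecP
import Data.Bool.Properties as BoolP
open import Data.Unit using (⊤)
open import Data.Product using (Σ; _×_)
open import Relation.Nullary.Decidable using (⌊_⌋)
open import Relation.Binary.PropositionalEquality using (_≡_)

Tuple : ℕ → ℕ → Set
Tuple n d = Vec (Subset n) d

Family : ℕ → ℕ → Set
Family n d = Tuple n d → Bool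

AllSize : ∀ {n d} → ℕ → Tuple n d → Set
AllSize r [] = ⊤
AllSize r (S ∷ Ss) = (∣ S ∣ ≡ r) × AllSize r Ss

IsFamilyOf : ∀ {n d} → ℕ → Family n d → Set
IsFamilyOf {n} {d} r F = (S : Tuple n d) → F S ≡ true → AllSize r S

allVecs : ∀ {A : Set} → List A → (m : ℕ) → List (Vec A m)
allVecs xs zero = [] ∷ []
allVecs xs (suc m) = concatMap (λ x → map (x ∷_) (allVecs xs m)) xs

allSubsets : (n : ℕ) → List (Subset n)
allSubsets n = allVecs (true ∷ false ∷ []) n

allTuples : (n d : ℕ) → List (Tuple n d)
allTuples n d = allVecs (allSubsets n) d

card : ∀ {n d} → Family n d → ℕ
card {n} {d} F = length (filter (λ S → T? (F S)) (allTuples n d))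

isDeletion : ∀ {n} → Subset n → Subset n → Bool
isDeletion {n} S T = any (λ x → lookup S x ∧ ⌊ VecP.≡-dec BoolP._≟_ T (S - x) ⌋) (allFin n)

isTupleDeletion : ∀ {n d} → Tuple n d → Tuple n d → Bool
isTupleDeletion S T = foldr _ _∧_ true (zipWith isDeletion S T)

shadow : ∀ {n d} → Family n d → Family n d
shadow {n} {d} F T = any (λ S → F S ∧ isTupleDeletion S T) (allTuples n d)

_<colex_ : ∀ {n} → Subset n → Subset n → Set
_<colex_ {n} A B = Σ (Fin n) λ i →
  (lookup B i ≡ true) × (lookup A i ≡ false) ×
  ((j : Fin n) → i <ᶠ j → lookup A j ≡ lookup B j)

Monotone : ∀ {n d} → ℕ → Family n d → Set
Monotone {n} {d} r F =
  (j : Fin d) (S : Tuple n d) (A B : Subset n) →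
  ∣ A ∣ ≡ r → A <colex B →
  F (S [ j ]≔ B) ≡ true → F (S [ j ]≔ A) ≡ true

module Submission where

open import Defs
open import Data.Nat using (ℕ; _≤_)
open import Data.Product using (Σ; _×_)
open import Relation.Binary.PropositionalEquality using (_≡_)

open import Data.Bool using (Bool; true; false; _∧_; _∨_; not; _≟_; T?)
open import Data.Bool.Properties as Bool using (T-≡; T-∧)
open import Data.Empty using (⊥; ⊥-elim)
open import Data.Fin using (Fin; zero; suc) renaming (_<_ to _<ᶠ_; _<?_ to _<ᶠ?_)
import Data.Fin.Properties as Fin
open import Data.Fin.Subset using (Subset; ∣_∣; _-_)
open import Data.Fin.Subset.Properties using (p─⊥≡p; anySubset?)
open import Data.List using (List; []; _∷_; _++_; map; filter; length; concatMap; cartesianProductWith; allFin)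
import Data.List.Properties as List
open import Data.List.Membership.Propositional using (_∈_; _∉_; lose)
open import Data.List.Membership.Propositional.Properties
  using (∈-map⁺; ∈-++⁺ˡ; ∈-++⁺ʳ; ∈-++⁻; ∈-∃++; ∈-cartesianProductWith⁺; ∈-allFin)
open import Data.List.Relation.Binary.Permutation.Propositional using (_↭_; ↭-refl; ↭-prep; ↭-trans; ↭-sym)
import Data.List.Relation.Binary.Permutation.Propositional.Properties as ↭
open import Data.List.Relation.Binary.Subset.Propositional using (_⊆_)
import Data.List.Relation.Unary.All as All
open import Data.List.Relation.Unary.Any as Any using (here; there; satisfied)
open import Data.List.Relation.Unary.Any.Properties using (any⁺; any⁻)
open import Data.List.Relation.Unary.Unique.Propositional using (Unique; []; _∷_)
import Data.List.Relation.Unary.Unique.Propositional.Properties as Unique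
open import Data.Nat using (zero; suc; _<_; _+_; _*_; z≤n; s≤s)
open import Data.Nat.Induction using (<-wellFounded)
open import Data.Nat.ListAction using (sum)
open import Data.Nat.ListAction.Properties using (sum-↭)
import Data.Nat.Properties as ℕ
open import Algebra.Properties.CommutativeSemigroup ℕ.+-commutativeSemigroup using (interchange)
open import Data.Product using (_,_; proj₁; proj₂)
open import Data.Sum using (_⊎_; inj₁; inj₂)
open import Data.Vec using (Vec; []; _∷_; lookup; tabulate; _[_]≔_)
import Data.Vec.Properties as Vec
open import Function using (_∘_; _on_; Equivalence)
open import Induction.WellFounded using (Acc; acc)
import Relation.Binary.Construct.On as On
open import Relation.Binary.PropositionalEquality
  using (refl; sym; trans; cong; cong₂; subst; subst₂; _≢_; module ≡-Reasoning)
open import Relation.Nullary using (¬_; Dec; yes; no; contradiction; ¬?)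
open import Relation.Nullary.Decidable using (map′; _×-dec_; _→-dec_; decidable-stable; toWitness; fromWitness)
open import Relation.Unary using (Decidable)

-- UV-compressions applied in one coordinate at a time, as in the proof of the
-- Kruskal–Katona theorem. For disjoint U, V of equal size whose largest element lies
-- in V, compressing coordinate j replaces V ⊆ X by U in the j-th set X of a tuple.
-- This pairs up tuples, and within each pair keeps only the colex-smaller one when
-- just one of the two is in the family. The size of the family is preserved, a colex
-- weight drops strictly unless the family is already compressed, and the shadow does
-- not grow provided the family is already compressed for the pairs (U - u, V - v):
-- the pairing maps every new shadow tuple to an old one that has left the shadow.
-- Always compressing along a pair with |U| minimal therefore terminates, and a family
-- that is compressed for every pair in every coordinate is monotone, because if
-- A <colex B and |A| = |B| then A is the (A ∖ B, B ∖ A)-compression of B.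

-- Sums over all tuples

module _ {X : Set} where

  ∈-++-insert : ∀ (as : List X) {x z bs} → z ∈ as ++ bs → z ∈ as ++ x ∷ bs
  ∈-++-insert as m with ∈-++⁻ as m
  ... | inj₁ p = ∈-++⁺ˡ p
  ... | inj₂ p = ∈-++⁺ʳ as (there p)

  unique-remove : ∀ (as : List X) {x bs} → Unique (as ++ x ∷ bs) → x ∉ as ++ bs × Unique (as ++ bs)
  unique-remove [] (x∉bs ∷ u) = (λ m → All.lookup x∉bs m refl) , u
  unique-remove (a ∷ as) {x} {bs} (a∉ ∷ u) with unique-remove as u
  ... | x∉ , u′ = x∉a∷ , All.tabulate (λ m → All.lookup a∉ (∈-++-insert as m)) ∷ u′
    where
    x∉a∷ : x ∉ a ∷ as ++ bs
    x∉a∷ (here refl) = All.lookup a∉ (∈-++⁺ʳ as (here refl)) refl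
    x∉a∷ (there m) = x∉ m

  unique-↭ : ∀ (xs : List X) {ys} → Unique xs → Unique ys → xs ⊆ ys → ys ⊆ xs → xs ↭ ys
  unique-↭ [] {[]} _ _ _ _ = ↭-refl
  unique-↭ [] {y ∷ ys} _ _ _ ys⊆ with ys⊆ (here refl)
  ... | ()
  unique-↭ (x ∷ xs) (x∉xs ∷ uxs) uys xs⊆ ys⊆ with ∈-∃++ (xs⊆ (here refl))
  ... | as , bs , refl with unique-remove as uys
  ... | x∉ , u′ = ↭-trans (↭-prep x (unique-↭ xs uxs u′ xs⊆′ ys⊆′)) (↭-sym (↭.shift x as bs))
    where
    xs⊆′ : xs ⊆ as ++ bs
    xs⊆′ {z} m with ∈-++⁻ as (xs⊆ (there m))
    ... | inj₁ p = ∈-++⁺ˡ p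
    ... | inj₂ (here refl) = ⊥-elim (All.lookup x∉xs m refl)
    ... | inj₂ (there p) = ∈-++⁺ʳ as p
    ys⊆′ : as ++ bs ⊆ xs
    ys⊆′ m with ys⊆ (∈-++-insert as m)
    ... | here refl = ⊥-elim (x∉ m)
    ... | there p = p

  sum-map-involution : (xs : List X) → Unique xs → (∀ x → x ∈ xs) →
    (σ : X → X) → (∀ x → σ (σ x) ≡ x) → (f : X → ℕ) →
    sum (map (f ∘ σ) xs) ≡ sum (map f xs)
  sum-map-involution xs u complete σ σ∘σ f = begin
    sum (map (f ∘ σ) xs)  ≡⟨ cong sum (List.map-∘ xs) ⟩
    sum (map f (map σ xs)) ≡⟨ sum-↭ (↭.map⁺ f σxs↭xs) ⟩
    sum (map f xs)         ∎
    where
    open ≡-Reasoning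
    σ-injective : ∀ {x y} → σ x ≡ σ y → x ≡ y
    σ-injective {x} {y} e = trans (sym (σ∘σ x)) (trans (cong σ e) (σ∘σ y))
    σxs↭xs : map σ xs ↭ xs
    σxs↭xs = unique-↭ (map σ xs) (Unique.map⁺ σ-injective u) u (λ {z} _ → complete z)
      (λ {z} _ → subst (_∈ map σ xs) (σ∘σ z) (∈-map⁺ σ (complete (σ z))))

allVecs-suc : ∀ {A : Set} (xs : List A) m →
  allVecs xs (suc m) ≡ cartesianProductWith _∷_ xs (allVecs xs m)
allVecs-suc xs m = go xs
  where
  go : ∀ ys → concatMap (λ y → map (y ∷_) (allVecs xs m)) ys ≡ cartesianProductWith _∷_ ys (allVecs xs m)
  go [] = refl
  go (y ∷ ys) = cong (map (y ∷_) (allVecs xs m) ++_) (go ys)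

allVecs-unique : ∀ {A : Set} {xs : List A} → Unique xs → ∀ m → Unique (allVecs xs m)
allVecs-unique u zero = All.[] ∷ []
allVecs-unique {xs = xs} u (suc m) rewrite allVecs-suc xs m =
  Unique.cartesianProductWith⁺ _∷_ (λ e → Vec.∷-injective e) u (allVecs-unique u m)

allVecs-complete : ∀ {A : Set} {xs : List A} → (∀ x → x ∈ xs) → ∀ m (v : Vec A m) → v ∈ allVecs xs m
allVecs-complete c zero [] = here refl
allVecs-complete {xs = xs} c (suc m) (x ∷ v) rewrite allVecs-suc xs m =
  ∈-cartesianProductWith⁺ _∷_ (c x) (allVecs-complete c m v)

allSubsets-complete : ∀ n (S : Subset n) → S ∈ allSubsets n
allSubsets-complete = allVecs-complete λ { true → here refl ; false → there (here refl) }

allTuples-unique : ∀ n d → Unique (allTuples n d)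
allTuples-unique n = allVecs-unique (allVecs-unique (((λ ()) All.∷ All.[]) ∷ All.[] ∷ []) n)

allTuples-complete : ∀ n d (A : Tuple n d) → A ∈ allTuples n d
allTuples-complete n = allVecs-complete (allSubsets-complete n)

⟦_⟧ : Bool → ℕ
⟦ true ⟧ = 1
⟦ false ⟧ = 0

length-filter-T : ∀ {X : Set} (p : X → Bool) xs →
  length (filter (T? ∘ p) xs) ≡ sum (map (⟦_⟧ ∘ p) xs)
length-filter-T p [] = refl
length-filter-T p (x ∷ xs) with p x
... | true = cong suc (length-filter-T p xs)
... | false = length-filter-T p xs

module _ {X : Set} (f g : X → ℕ) where

  sum-map-+ : ∀ xs → sum (map (λ x → f x + g x) xs) ≡ sum (map f xs) + sum (map g xs)
  sum-map-+ [] = refl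
  sum-map-+ (x ∷ xs) = trans (cong (f x + g x +_) (sum-map-+ xs)) (interchange (f x) (g x) _ _)

  sum-map-mono-≤ : (∀ x → f x ≤ g x) → ∀ xs → sum (map f xs) ≤ sum (map g xs)
  sum-map-mono-≤ f≤g [] = z≤n
  sum-map-mono-≤ f≤g (x ∷ xs) = ℕ.+-mono-≤ (f≤g x) (sum-map-mono-≤ f≤g xs)

  sum-map-mono-< : (∀ x → f x ≤ g x) → ∀ {y xs} → y ∈ xs → f y < g y → sum (map f xs) < sum (map g xs)
  sum-map-mono-< f≤g {xs = x ∷ xs} (here refl) lt = ℕ.+-mono-<-≤ lt (sum-map-mono-≤ f≤g xs)
  sum-map-mono-< f≤g {xs = x ∷ xs} (there m) lt = ℕ.+-mono-≤-< (f≤g x) (sum-map-mono-< f≤g m lt)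

module _ {n d : ℕ} where

  ∑ : (Tuple n d → ℕ) → ℕ
  ∑ f = sum (map f (allTuples n d))

  card-∑ : (G : Family n d) → card G ≡ ∑ (⟦_⟧ ∘ G)
  card-∑ G = length-filter-T G (allTuples n d)

  ∑-+ : ∀ f g → ∑ (λ A → f A + g A) ≡ ∑ f + ∑ g
  ∑-+ f g = sum-map-+ f g (allTuples n d)

  ∑-cong : ∀ {f g} → (∀ A → f A ≡ g A) → ∑ f ≡ ∑ g
  ∑-cong f≗g = cong sum (List.map-cong f≗g (allTuples n d))

  ∑-mono-≤ : ∀ {f g} → (∀ A → f A ≤ g A) → ∑ f ≤ ∑ g
  ∑-mono-≤ {f} {g} f≤g = sum-map-mono-≤ f g f≤g (allTuples n d)

  ∑-mono-< : ∀ {f g} → (∀ A → f A ≤ g A) → ∀ B → f B < g B → ∑ f < ∑ g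
  ∑-mono-< {f} {g} f≤g B = sum-map-mono-< f g f≤g (allTuples-complete n d B)

  module _ (σ : Tuple n d → Tuple n d) (σ∘σ : ∀ A → σ (σ A) ≡ A) where

    ∑-∘-involution : ∀ f → ∑ (f ∘ σ) ≡ ∑ f
    ∑-∘-involution = sum-map-involution (allTuples n d) (allTuples-unique n d) (allTuples-complete n d) σ σ∘σ

    ∑-orbit : ∀ f → ∑ (λ A → f A + f (σ A)) ≡ 2 * ∑ f
    ∑-orbit f = begin
      ∑ (λ A → f A + f (σ A)) ≡⟨ ∑-+ f (f ∘ σ) ⟩
      ∑ f + ∑ (f ∘ σ)         ≡⟨ cong (∑ f +_) (∑-∘-involution f) ⟩
      ∑ f + ∑ f               ≡⟨ cong (∑ f +_) (sym (ℕ.+-identityʳ (∑ f))) ⟩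
      2 * ∑ f                 ∎
      where open ≡-Reasoning

    ∑-orbitwise-≡ : ∀ f g → (∀ A → f A + f (σ A) ≡ g A + g (σ A)) → ∑ f ≡ ∑ g
    ∑-orbitwise-≡ f g h = ℕ.*-cancelˡ-≡ (∑ f) (∑ g) 2
      (trans (sym (∑-orbit f)) (trans (∑-cong h) (∑-orbit g)))

    ∑-orbitwise-< : ∀ f g → (∀ A → f A + f (σ A) ≤ g A + g (σ A)) →
      ∀ B → f B + f (σ B) < g B + g (σ B) → ∑ f < ∑ g
    ∑-orbitwise-< f g h B lt = ℕ.*-cancelˡ-< 2 (∑ f) (∑ g)
      (subst₂ _<_ (∑-orbit f) (∑-orbit g) (∑-mono-< h B lt))

    card-≤-by-involution : (F G : Family n d) →
      (∀ B → F B ≡ true → G B ≡ false → G (σ B) ≡ true × F (σ B) ≡ false) →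
      card F ≤ card G
    card-≤-by-involution F G move = subst₂ _≤_ (sym (card-∑ F)) (sym (card-∑ G)) (begin
      ∑ (⟦_⟧ ∘ F)                   ≤⟨ ∑-mono-≤ bound ⟩
      ∑ (λ B → both B + new (σ B))  ≡⟨ ∑-+ both (new ∘ σ) ⟩
      ∑ both + ∑ (new ∘ σ)          ≡⟨ cong (∑ both +_) (∑-∘-involution new) ⟩
      ∑ both + ∑ new                ≡⟨ ∑-+ both new ⟨
      ∑ (λ B → both B + new B)      ≡⟨ ∑-cong split ⟩
      ∑ (⟦_⟧ ∘ G)                   ∎)
      where
      open ℕ.≤-Reasoning
      both new : Tuple n d → ℕ
      both B = ⟦ F B ∧ G B ⟧
      new B = ⟦ G B ∧ not (F B) ⟧
      bound : ∀ B → ⟦ F B ⟧ ≤ both B + new (σ B)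
      bound B with F B in FB | G B in GB
      ... | false | _ = z≤n
      ... | true | true = s≤s z≤n
      ... | true | false with move B FB GB
      ...   | GσB , FσB rewrite GσB | FσB = s≤s z≤n
      split : ∀ B → both B + new B ≡ ⟦ G B ⟧
      split B with F B | G B
      ... | true | true = refl
      ... | true | false = refl
      ... | false | true = refl
      ... | false | false = refl

-- Subsets and UV-compressions

lookup-ext : ∀ {A : Set} {m} (xs ys : Vec A m) → (∀ i → lookup xs i ≡ lookup ys i) → xs ≡ ys
lookup-ext xs ys h = trans (sym (Vec.tabulate∘lookup xs)) (trans (Vec.tabulate-cong h) (Vec.tabulate∘lookup ys))

true≢false : true ≢ false
true≢false ()

module _ {n : ℕ} where

  _⊆ˢ_ : Subset n → Subset n → Set
  V ⊆ˢ X = ∀ k → lookup V k ≡ true → lookup X k ≡ true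

  Disjoint : Subset n → Subset n → Set
  Disjoint U X = ∀ k → lookup U k ≡ true → lookup X k ≡ false

  Compressible : (U V X : Subset n) → Set
  Compressible U V X = V ⊆ˢ X × Disjoint U X

  compress : (U V X : Subset n) → Subset n
  compress U V X = tabulate λ k → (lookup X k ∧ not (lookup V k)) ∨ lookup U k

  lookup-compress : ∀ U V X k → lookup (compress U V X) k ≡ (lookup X k ∧ not (lookup V k)) ∨ lookup U k
  lookup-compress U V X = Vec.lookup∘tabulate _

  _⊆ˢ?_ : ∀ V X → Dec (V ⊆ˢ X)
  V ⊆ˢ? X = Fin.all? λ k → (lookup V k ≟ true) →-dec (lookup X k ≟ true)

  disjoint? : ∀ U X → Dec (Disjoint U X)
  disjoint? U X = Fin.all? λ k → (lookup U k ≟ true) →-dec (lookup X k ≟ false)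

  compressible? : ∀ U V X → Dec (Compressible U V X)
  compressible? U V X = (V ⊆ˢ? X) ×-dec disjoint? U X

  ∈∧Disjoint⇒∉ : ∀ P X x → lookup X x ≡ true → Disjoint P X → lookup P x ≡ false
  ∈∧Disjoint⇒∉ P X x Xx P∩X≡∅ with lookup P x in Px
  ... | false = refl
  ... | true = contradiction (trans (sym Xx) (P∩X≡∅ x Px)) true≢false

  Disjoint-sym : ∀ U V → Disjoint U V → Disjoint V U
  Disjoint-sym U V U∩V≡∅ k Vk = ∈∧Disjoint⇒∉ U V k Vk U∩V≡∅

  compress-undoᵇ : ∀ x u v → (v ≡ true → x ≡ true) → (u ≡ true → x ≡ false) → (u ≡ true → v ≡ false) →
    (((x ∧ not v) ∨ u) ∧ not u) ∨ v ≡ x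
  compress-undoᵇ true true _ _ u⇒¬x _ = contradiction (u⇒¬x refl) true≢false
  compress-undoᵇ false true true _ _ u⇒¬v = contradiction (u⇒¬v refl) true≢false
  compress-undoᵇ false false true v⇒x _ _ = contradiction (v⇒x refl) (λ ())
  compress-undoᵇ true false true _ _ _ = refl
  compress-undoᵇ true false false _ _ _ = refl
  compress-undoᵇ false true false _ _ _ = refl
  compress-undoᵇ false false false _ _ _ = refl

  module _ (U V : Subset n) (U∩V≡∅ : Disjoint U V) where

    compress-undoᵏ : ∀ X → Compressible U V X → ∀ k →
      (lookup X k ∧ not (lookup V k) ∨ lookup U k) ∧ not (lookup U k) ∨ lookup V k ≡ lookup X k
    compress-undoᵏ X (V⊆X , U∩X≡∅) k = compress-undoᵇ _ _ _ (V⊆X k) (U∩X≡∅ k) (U∩V≡∅ k)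

    compress-compressible : ∀ X → Compressible U V X → Compressible V U (compress U V X)
    compress-compressible X (V⊆X , U∩X≡∅) = U⊆ , V∩≡∅
      where
      U⊆ : U ⊆ˢ compress U V X
      U⊆ k Uk rewrite lookup-compress U V X k | Uk = Bool.∨-zeroʳ _
      V∩≡∅ : Disjoint V (compress U V X)
      V∩≡∅ k Vk rewrite lookup-compress U V X k | Vk | Bool.∧-zeroʳ (lookup X k) =
        Disjoint-sym U V U∩V≡∅ k Vk

    compress-involutive : ∀ X → Compressible U V X → compress V U (compress U V X) ≡ X
    compress-involutive X c = lookup-ext _ _ λ k → begin
      lookup (compress V U (compress U V X)) k
        ≡⟨ lookup-compress V U (compress U V X) k ⟩
      (lookup (compress U V X) k ∧ not (lookup U k)) ∨ lookup V k
        ≡⟨ cong (λ b → (b ∧ not (lookup U k)) ∨ lookup V k) (lookup-compress U V X k) ⟩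
      ((lookup X k ∧ not (lookup V k) ∨ lookup U k) ∧ not (lookup U k)) ∨ lookup V k
        ≡⟨ compress-undoᵏ X c k ⟩
      lookup X k ∎
      where open ≡-Reasoning

  compress-∅ : ∀ U V X → (∀ k → lookup U k ≡ false) → (∀ k → lookup V k ≡ false) → compress U V X ≡ X
  compress-∅ U V X U≡∅ V≡∅ = lookup-ext _ _ λ k → begin
    lookup (compress U V X) k                    ≡⟨ lookup-compress U V X k ⟩
    (lookup X k ∧ not (lookup V k)) ∨ lookup U k
      ≡⟨ cong₂ (λ v u → (lookup X k ∧ not v) ∨ u) (V≡∅ k) (U≡∅ k) ⟩
    (lookup X k ∧ true) ∨ false                   ≡⟨ Bool.∨-identityʳ _ ⟩
    lookup X k ∧ true                            ≡⟨ Bool.∧-identityʳ _ ⟩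
    lookup X k                                   ∎
    where open ≡-Reasoning

lookup-del-same : ∀ {n} (S : Subset n) x → lookup (S - x) x ≡ false
lookup-del-same (s ∷ S) zero = refl
lookup-del-same (s ∷ S) (suc x) = lookup-del-same S x

lookup-del-other : ∀ {n} (S : Subset n) {x k} → k ≢ x → lookup (S - x) k ≡ lookup S k
lookup-del-other (s ∷ S) {zero} {zero} k≢x = contradiction refl k≢x
lookup-del-other (s ∷ S) {zero} {suc k} _ = cong (λ Z → lookup Z k) (p─⊥≡p S)
lookup-del-other (true ∷ S) {suc x} {zero} _ = refl
lookup-del-other (false ∷ S) {suc x} {zero} _ = refl
lookup-del-other (true ∷ S) {suc x} {suc k} k≢x = lookup-del-other S (k≢x ∘ cong suc)
lookup-del-other (false ∷ S) {suc x} {suc k} k≢x = lookup-del-other S (k≢x ∘ cong suc)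

del-⊆ˢ : ∀ {n} (S : Subset n) x → (S - x) ⊆ˢ S
del-⊆ˢ S x k e with k Fin.≟ x
... | yes refl = contradiction (trans (sym e) (lookup-del-same S k)) true≢false
... | no k≢x = trans (sym (lookup-del-other S k≢x)) e

lookup-del-false : ∀ {n} (S : Subset n) x {k} → lookup S k ≡ false → lookup (S - x) k ≡ false
lookup-del-false S x {k} e with k Fin.≟ x
... | yes refl = lookup-del-same S k
... | no k≢x = trans (lookup-del-other S k≢x) e

∣∷∣ : ∀ {n} s (S : Subset n) → ∣ s ∷ S ∣ ≡ ⟦ s ⟧ + ∣ S ∣
∣∷∣ true S = refl
∣∷∣ false S = refl

∣∣-+-pointwise : ∀ {n} (P Q R S : Subset n) →
  (∀ k → ⟦ lookup P k ⟧ + ⟦ lookup Q k ⟧ ≡ ⟦ lookup R k ⟧ + ⟦ lookup S k ⟧) →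
  ∣ P ∣ + ∣ Q ∣ ≡ ∣ R ∣ + ∣ S ∣
∣∣-+-pointwise [] [] [] [] _ = refl
∣∣-+-pointwise (p ∷ P) (q ∷ Q) (r ∷ R) (s ∷ S) h
  rewrite ∣∷∣ p P | ∣∷∣ q Q | ∣∷∣ r R | ∣∷∣ s S = begin
    (⟦ p ⟧ + ∣ P ∣) + (⟦ q ⟧ + ∣ Q ∣) ≡⟨ interchange ⟦ p ⟧ (∣ P ∣) ⟦ q ⟧ (∣ Q ∣) ⟩
    (⟦ p ⟧ + ⟦ q ⟧) + (∣ P ∣ + ∣ Q ∣)
      ≡⟨ cong₂ _+_ (h zero) (∣∣-+-pointwise P Q R S (h ∘ suc)) ⟩
    (⟦ r ⟧ + ⟦ s ⟧) + (∣ R ∣ + ∣ S ∣) ≡⟨ interchange ⟦ r ⟧ ⟦ s ⟧ (∣ R ∣) (∣ S ∣) ⟩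
    (⟦ r ⟧ + ∣ R ∣) + (⟦ s ⟧ + ∣ S ∣) ∎
  where open ≡-Reasoning

compress-size : ∀ {n} (U V X : Subset n) → Compressible U V X → ∣ U ∣ ≡ ∣ V ∣ → ∣ compress U V X ∣ ≡ ∣ X ∣
compress-size U V X (V⊆X , U∩X≡∅) ∣U∣≡∣V∣ = ℕ.+-cancelʳ-≡ (∣ V ∣) _ _
  (trans (∣∣-+-pointwise (compress U V X) V X U pointwise) (cong (∣ X ∣ +_) ∣U∣≡∣V∣))
  where
  count : ∀ x u v → (v ≡ true → x ≡ true) → (u ≡ true → x ≡ false) →
    ⟦ (x ∧ not v) ∨ u ⟧ + ⟦ v ⟧ ≡ ⟦ x ⟧ + ⟦ u ⟧
  count true true _ _ u⇒¬x = contradiction (u⇒¬x refl) true≢false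
  count false _ true v⇒x _ = contradiction (v⇒x refl) (λ ())
  count true false true _ _ = refl
  count true false false _ _ = refl
  count false true false _ _ = refl
  count false false false _ _ = refl
  pointwise : ∀ k → ⟦ lookup (compress U V X) k ⟧ + ⟦ lookup V k ⟧ ≡ ⟦ lookup X k ⟧ + ⟦ lookup U k ⟧
  pointwise k rewrite lookup-compress U V X k = count _ _ _ (V⊆X k) (U∩X≡∅ k)

∣del∣ : ∀ {n} (S : Subset n) x → lookup S x ≡ true → suc ∣ S - x ∣ ≡ ∣ S ∣
∣del∣ (true ∷ S) zero _ = cong (suc ∘ ∣_∣) (p─⊥≡p S)
∣del∣ (s ∷ S) (suc x) Sx = begin
  suc ∣ s ∷ (S - x) ∣     ≡⟨ cong suc (∣∷∣ s (S - x)) ⟩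
  suc (⟦ s ⟧ + ∣ S - x ∣) ≡⟨ ℕ.+-suc ⟦ s ⟧ (∣ S - x ∣) ⟨
  ⟦ s ⟧ + suc ∣ S - x ∣   ≡⟨ cong (⟦ s ⟧ +_) (∣del∣ S x Sx) ⟩
  ⟦ s ⟧ + ∣ S ∣           ≡⟨ ∣∷∣ s S ⟨
  ∣ s ∷ S ∣               ∎
  where open ≡-Reasoning

∣∣≡0⇒empty : ∀ {n} (S : Subset n) → ∣ S ∣ ≡ 0 → ∀ k → lookup S k ≡ false
∣∣≡0⇒empty (false ∷ S) e zero = refl
∣∣≡0⇒empty (false ∷ S) e (suc k) = ∣∣≡0⇒empty S e k

∣∣≡suc⇒nonempty : ∀ {n m} (S : Subset n) → ∣ S ∣ ≡ suc m → Σ (Fin n) λ k → lookup S k ≡ true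
∣∣≡suc⇒nonempty (true ∷ S) _ = zero , refl
∣∣≡suc⇒nonempty (false ∷ S) e with ∣∣≡suc⇒nonempty S e
... | k , Sk = suc k , Sk

value : ∀ {n} → Subset n → ℕ
value [] = 0
value (b ∷ S) = ⟦ b ⟧ + 2 * value S

colex⇒value< : ∀ {n} (A B : Subset n) → A <colex B → value A < value B
colex⇒value< (a ∷ A) (b ∷ B) (zero , refl , refl , agree)
  rewrite lookup-ext A B (λ k → agree (suc k) (s≤s z≤n)) = ℕ.n<1+n _
colex⇒value< (a ∷ A) (b ∷ B) (suc i , Bi , Ai , agree) = begin-strict
  ⟦ a ⟧ + 2 * value A <⟨ ℕ.+-monoˡ-< (2 * value A) (⟦⟧<2 a) ⟩
  2 + 2 * value A     ≡⟨ ℕ.*-suc 2 (value A) ⟨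
  2 * suc (value A)   ≤⟨ ℕ.*-monoʳ-≤ 2 (colex⇒value< A B (i , Bi , Ai , λ k lt → agree (suc k) (s≤s lt))) ⟩
  2 * value B         ≤⟨ ℕ.m≤n+m _ ⟦ b ⟧ ⟩
  ⟦ b ⟧ + 2 * value B ∎
  where
  open ℕ.≤-Reasoning
  ⟦⟧<2 : ∀ b → ⟦ b ⟧ < 2
  ⟦⟧<2 true = s≤s (s≤s z≤n)
  ⟦⟧<2 false = s≤s z≤n

IsDeletion : ∀ {n} → Subset n → Subset n → Set
IsDeletion {n} S T = Σ (Fin n) λ x → (lookup S x ≡ true) × (T ≡ S - x)

module _ {n} (P Q : Subset n) where

  del-compressible : ∀ X x → lookup Q x ≡ false → Compressible P Q X → Compressible P Q (X - x)
  del-compressible X x Qx (Q⊆X , P∩X≡∅) = Q⊆ , P∩≡∅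
    where
    Q⊆ : Q ⊆ˢ (X - x)
    Q⊆ k Qk with k Fin.≟ x
    ... | yes refl = contradiction (trans (sym Qk) Qx) true≢false
    ... | no k≢x = trans (lookup-del-other X k≢x) (Q⊆X k Qk)
    P∩≡∅ : Disjoint P (X - x)
    P∩≡∅ k Pk = lookup-del-false X x (P∩X≡∅ k Pk)

  compress-del : ∀ X x → lookup X x ≡ true → lookup Q x ≡ false → Compressible P Q X →
    IsDeletion (compress P Q X) (compress P Q (X - x))
  compress-del X x Xx Qx (Q⊆X , P∩X≡∅) = x , compress-x , lookup-ext _ _ pointwise
    where
    compress-x : lookup (compress P Q X) x ≡ true
    compress-x rewrite lookup-compress P Q X x | Xx | Qx = refl
    pointwise : ∀ k → lookup (compress P Q (X - x)) k ≡ lookup (compress P Q X - x) k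
    pointwise k with k Fin.≟ x
    ... | yes refl rewrite lookup-del-same (compress P Q X) k | lookup-compress P Q (X - k) k
                         | lookup-del-same X k = ∈∧Disjoint⇒∉ P X k Xx P∩X≡∅
    ... | no k≢x rewrite lookup-del-other (compress P Q X) k≢x | lookup-compress P Q (X - x) k
                       | lookup-compress P Q X k | lookup-del-other X k≢x = refl

module _ {n} (U V : Subset n) (U∩V≡∅ : Disjoint U V) where

  shrink-del-preimage : ∀ X x v → lookup U x ≡ true → lookup V v ≡ true → Compressible V U X →
    Compressible (U - x) (V - v) (compress V U X) × IsDeletion (compress (U - x) (V - v) (compress V U X)) (X - x)
  shrink-del-preimage X x v Ux Vv c@(U⊆X , V∩X≡∅) =
    (V-v⊆W , U-x∩W≡∅) , v , Zv , lookup-ext _ _ pointwise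
    where
    W = compress V U X
    Z = compress (U - x) (V - v) W
    Xx : lookup X x ≡ true
    Xx = U⊆X x Ux
    V-v⊆W : (V - v) ⊆ˢ W
    V-v⊆W k e rewrite lookup-compress V U X k | del-⊆ˢ V v k e = Bool.∨-zeroʳ _
    U-x∩W≡∅ : Disjoint (U - x) W
    U-x∩W≡∅ k e rewrite lookup-compress V U X k | del-⊆ˢ U x k e | Bool.∧-zeroʳ (lookup X k) =
      U∩V≡∅ k (del-⊆ˢ U x k e)
    Zv : lookup Z v ≡ true
    Zv rewrite lookup-compress (U - x) (V - v) W v | lookup-del-same V v | lookup-compress V U X v | Vv
             | Bool.∨-zeroʳ (lookup X v ∧ not (lookup U v)) = refl
    pointwise : ∀ k → lookup (X - x) k ≡ lookup (Z - v) k
    pointwise k with k Fin.≟ v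
    ... | yes refl rewrite lookup-del-same Z k with k Fin.≟ x
    ...   | yes refl = lookup-del-same X k
    ...   | no k≢x = trans (lookup-del-other X k≢x) (V∩X≡∅ k Vv)
    pointwise k | no k≢v rewrite lookup-del-other Z k≢v | lookup-compress (U - x) (V - v) W k
                               | lookup-del-other V k≢v with k Fin.≟ x
    ... | yes refl rewrite lookup-del-same X k | lookup-del-same U k | lookup-compress V U X k | Xx | Ux
                         | ∈∧Disjoint⇒∉ V X k Xx V∩X≡∅ = refl
    ... | no k≢x rewrite lookup-del-other X k≢x | lookup-del-other U k≢x | lookup-compress V U X k =
      sym (compress-undoᵏ V U (Disjoint-sym U V U∩V≡∅) X c k)

  module ParentOfImage (B Y : Subset n) (y : Fin n) (B-compressible : Compressible V U B)
                       (Yy : lookup Y y ≡ true) (image≡Y-y : compress V U B ≡ Y - y) where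

    private
      U⊆B = proj₁ B-compressible
      V∩B≡∅ = proj₂ B-compressible

      lookup-Y-y : ∀ k → (lookup B k ∧ not (lookup U k)) ∨ lookup V k ≡ lookup (Y - y) k
      lookup-Y-y k = trans (sym (lookup-compress V U B k)) (cong (λ Z → lookup Z k) image≡Y-y)

      lookup-Y : ∀ k → k ≢ y → lookup Y k ≡ (lookup B k ∧ not (lookup U k)) ∨ lookup V k
      lookup-Y k k≢y = trans (sym (lookup-del-other Y k≢y)) (sym (lookup-Y-y k))

      image-y : (lookup B y ∧ not (lookup U y)) ∨ lookup V y ≡ false
      image-y = trans (lookup-Y-y y) (lookup-del-same Y y)

      Vy : lookup V y ≡ false
      Vy = Bool.∨-conicalʳ _ _ image-y

      B≡compress-undo : ∀ k → k ≢ y → lookup B k ≡ (lookup Y k ∧ not (lookup V k)) ∨ lookup U k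
      B≡compress-undo k k≢y rewrite lookup-Y k k≢y =
        sym (compress-undoᵏ V U (Disjoint-sym U V U∩V≡∅) B B-compressible k)

    V⊆Y : V ⊆ˢ Y
    V⊆Y k Vk = del-⊆ˢ Y y k (trans (sym (lookup-Y-y k)) (trans (cong (_ ∨_) Vk) (Bool.∨-zeroʳ _)))

    compressible⇒del : Compressible U V Y → IsDeletion (compress U V Y) B
    compressible⇒del (_ , U∩Y≡∅) = y , compress-y , lookup-ext _ _ pointwise
      where
      Uy : lookup U y ≡ false
      Uy = ∈∧Disjoint⇒∉ U Y y Yy U∩Y≡∅
      compress-y : lookup (compress U V Y) y ≡ true
      compress-y rewrite lookup-compress U V Y y | Yy | Vy = refl
      pointwise : ∀ k → lookup B k ≡ lookup (compress U V Y - y) k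
      pointwise k with k Fin.≟ y
      ... | yes refl rewrite lookup-del-same (compress U V Y) k = trans (sym (Bool.∧-identityʳ (lookup B k)))
        (subst (λ u → lookup B k ∧ not u ≡ false) Uy (Bool.∨-conicalˡ _ _ image-y))
      ... | no k≢y rewrite lookup-del-other (compress U V Y) k≢y | lookup-compress U V Y k =
        B≡compress-undo k k≢y

    incompressible⇒∈U : ¬ Compressible U V Y → lookup U y ≡ true
    incompressible⇒∈U ¬c with disjoint? U Y
    ... | yes U∩Y≡∅ = contradiction (V⊆Y , U∩Y≡∅) ¬c
    ... | no ¬U∩Y≡∅ with Fin.¬∀⟶∃¬ n _ (λ k → (lookup U k ≟ true) →-dec (lookup Y k ≟ false)) ¬U∩Y≡∅
    ...   | k , ¬k with lookup U k in Uk | lookup Y k in Yk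
    ...     | false | _ = contradiction (λ ()) ¬k
    ...     | true | false = contradiction (λ _ → refl) ¬k
    ...     | true | true with k Fin.≟ y
    ...       | yes refl = Uk
    ...       | no k≢y = contradiction (trans (sym Yk) (trans (lookup-Y k k≢y) Y-false)) true≢false
      where
      Y-false : (lookup B k ∧ not (lookup U k)) ∨ lookup V k ≡ false
      Y-false rewrite Uk | Bool.∧-zeroʳ (lookup B k) = U∩V≡∅ k Uk

    shrink-del : ∀ v → lookup U y ≡ true → lookup V v ≡ true →
      Compressible (U - y) (V - v) Y × IsDeletion (compress (U - y) (V - v) Y) B
    shrink-del v Uy Vv = (V-v⊆Y , U-y∩Y≡∅) , v , Zv , lookup-ext _ _ pointwise
      where
      Z = compress (U - y) (V - v) Y
      V-v⊆Y : (V - v) ⊆ˢ Y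
      V-v⊆Y k e = V⊆Y k (del-⊆ˢ V v k e)
      U-y∩Y≡∅ : Disjoint (U - y) Y
      U-y∩Y≡∅ k e with k Fin.≟ y
      ... | yes refl = contradiction (trans (sym e) (lookup-del-same U k)) true≢false
      ... | no k≢y rewrite lookup-Y k k≢y | del-⊆ˢ U y k e | Bool.∧-zeroʳ (lookup B k) =
        U∩V≡∅ k (del-⊆ˢ U y k e)
      Zv : lookup Z v ≡ true
      Zv rewrite lookup-compress (U - y) (V - v) Y v | lookup-del-same V v | V⊆Y v Vv = refl
      pointwise : ∀ k → lookup B k ≡ lookup (Z - v) k
      pointwise k with k Fin.≟ v
      ... | yes refl rewrite lookup-del-same Z k = V∩B≡∅ k Vv
      ... | no k≢v rewrite lookup-del-other Z k≢v | lookup-compress (U - y) (V - v) Y k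
                         | lookup-del-other V k≢v with k Fin.≟ y
      ...   | yes refl rewrite lookup-del-same U k | Yy | U∩V≡∅ k Uy = U⊆B k Uy
      ...   | no k≢y rewrite lookup-del-other U k≢y = B≡compress-undo k k≢y

-- Compressing a family in one coordinate

record CompressionPair {n} (U V : Subset n) : Set where
  field
    disjoint : Disjoint U V
    sameSize : ∣ U ∣ ≡ ∣ V ∣
    top      : Fin n
    top∈V    : lookup V top ≡ true
    aboveTop : ∀ k → top <ᶠ k → lookup U k ≡ false × lookup V k ≡ false

weight : ∀ {n d} → Tuple n d → ℕ
weight [] = 0
weight (S ∷ A) = value S + weight A

weight-[]≔-< : ∀ {n d} (A : Tuple n d) j Y → value Y < value (lookup A j) → weight (A [ j ]≔ Y) < weight A
weight-[]≔-< (S ∷ A) zero Y lt = ℕ.+-monoˡ-< (weight A) lt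
weight-[]≔-< (S ∷ A) (suc j) Y lt = ℕ.+-monoʳ-< (value S) (weight-[]≔-< A j Y lt)

lookup-[]≔-size : ∀ {n d r} (A : Tuple n d) j → AllSize r A → ∣ lookup A j ∣ ≡ r
lookup-[]≔-size (S ∷ A) zero (e , _) = e
lookup-[]≔-size (S ∷ A) (suc j) (_ , h) = lookup-[]≔-size A j h

AllSize-[]≔ : ∀ {n d r} (A : Tuple n d) j Y → AllSize r A → ∣ Y ∣ ≡ r → AllSize r (A [ j ]≔ Y)
AllSize-[]≔ (S ∷ A) zero Y (_ , h) e = e , h
AllSize-[]≔ (S ∷ A) (suc j) Y (e′ , h) e = e′ , AllSize-[]≔ A j Y h e

totalWeight : ∀ {n d} → Family n d → ℕ
totalWeight G = ∑ λ A → ⟦ G A ⟧ * weight A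

Compressed : ∀ {n d} → Fin d → Subset n → Subset n → Family n d → Set
Compressed {n} {d} j U V G = ∀ (A : Tuple n d) → Compressible U V (lookup A j) → G A ≡ true →
  G (A [ j ]≔ compress U V (lookup A j)) ≡ true

data Position : Set where
  movable image fixed : Position

combine : Position → Bool → Bool → Bool
combine movable a b = a ∧ b
combine image a b = a ∨ b
combine fixed a b = a

⟦∧⟧+⟦∨⟧ : ∀ a b → ⟦ a ∧ b ⟧ + ⟦ b ∨ a ⟧ ≡ ⟦ a ⟧ + ⟦ b ⟧
⟦∧⟧+⟦∨⟧ true true = refl
⟦∧⟧+⟦∨⟧ true false = refl
⟦∧⟧+⟦∨⟧ false true = refl
⟦∧⟧+⟦∨⟧ false false = refl

combine-true : ∀ P a b → combine P a b ≡ true → a ≡ true ⊎ b ≡ true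
combine-true movable true _ _ = inj₁ refl
combine-true image true _ _ = inj₁ refl
combine-true image false _ e = inj₂ e
combine-true fixed _ _ e = inj₁ e

combine-count-down : ∀ {P P′} → P ≡ movable → P′ ≡ image →
  ∀ a b → ⟦ combine P a b ⟧ + ⟦ combine P′ b a ⟧ ≡ ⟦ a ⟧ + ⟦ b ⟧
combine-count-down refl refl = ⟦∧⟧+⟦∨⟧

combine-count-up : ∀ {P P′} → P ≡ image → P′ ≡ movable →
  ∀ a b → ⟦ combine P a b ⟧ + ⟦ combine P′ b a ⟧ ≡ ⟦ a ⟧ + ⟦ b ⟧
combine-count-up refl refl a b =
  trans (ℕ.+-comm ⟦ a ∨ b ⟧ ⟦ b ∧ a ⟧) (trans (⟦∧⟧+⟦∨⟧ b a) (ℕ.+-comm ⟦ b ⟧ ⟦ a ⟧))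

combine-count-fixed : ∀ {P P′} → P ≡ fixed → P′ ≡ fixed →
  ∀ a b → ⟦ combine P a b ⟧ + ⟦ combine P′ b a ⟧ ≡ ⟦ a ⟧ + ⟦ b ⟧
combine-count-fixed refl refl _ _ = refl

move-down-≤ : ∀ a b {w₁ w₂} → w₂ ≤ w₁ → ⟦ a ∧ b ⟧ * w₁ + ⟦ b ∨ a ⟧ * w₂ ≤ ⟦ a ⟧ * w₁ + ⟦ b ⟧ * w₂
move-down-≤ true true _ = ℕ.≤-refl
move-down-≤ true false w₂≤w₁ = ℕ.+-monoˡ-≤ 0 (ℕ.m≤n⇒m≤n+o 0 w₂≤w₁)
move-down-≤ false true _ = ℕ.≤-refl
move-down-≤ false false _ = ℕ.≤-refl

combine-weight-down : ∀ {P P′} → P ≡ movable → P′ ≡ image → ∀ a b {w₁ w₂} → w₂ ≤ w₁ →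
  ⟦ combine P a b ⟧ * w₁ + ⟦ combine P′ b a ⟧ * w₂ ≤ ⟦ a ⟧ * w₁ + ⟦ b ⟧ * w₂
combine-weight-down refl refl = move-down-≤

combine-weight-up : ∀ {P P′} → P ≡ image → P′ ≡ movable → ∀ a b {w₁ w₂} → w₁ ≤ w₂ →
  ⟦ combine P a b ⟧ * w₁ + ⟦ combine P′ b a ⟧ * w₂ ≤ ⟦ a ⟧ * w₁ + ⟦ b ⟧ * w₂
combine-weight-up refl refl a b {w₁} {w₂} w₁≤w₂ = subst₂ _≤_
  (ℕ.+-comm (⟦ b ∧ a ⟧ * w₂) (⟦ a ∨ b ⟧ * w₁)) (ℕ.+-comm (⟦ b ⟧ * w₂) (⟦ a ⟧ * w₁))
  (move-down-≤ b a w₁≤w₂)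

combine-weight-fixed : ∀ {P P′} → P ≡ fixed → P′ ≡ fixed → ∀ a b {w₁ w₂} →
  ⟦ combine P a b ⟧ * w₁ + ⟦ combine P′ b a ⟧ * w₂ ≤ ⟦ a ⟧ * w₁ + ⟦ b ⟧ * w₂
combine-weight-fixed refl refl _ _ = ℕ.≤-refl

combine-weight-strict : ∀ {P P′ a b} → P ≡ movable → P′ ≡ image → a ≡ true → b ≡ false → ∀ {w₁ w₂} → w₂ < w₁ →
  ⟦ combine P a b ⟧ * w₁ + ⟦ combine P′ b a ⟧ * w₂ < ⟦ a ⟧ * w₁ + ⟦ b ⟧ * w₂
combine-weight-strict refl refl refl refl w₂<w₁ = ℕ.+-monoˡ-< 0 (ℕ.m≤n⇒m≤n+o 0 w₂<w₁)

module Compression {n d : ℕ} (j : Fin d) {U V : Subset n} (pair : CompressionPair U V) where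
  open CompressionPair pair

  position : Subset n → Position
  position X with compressible? U V X | compressible? V U X
  ... | yes _ | _ = movable
  ... | no _ | yes _ = image
  ... | no _ | no _ = fixed

  data PositionView (X : Subset n) : Position → Set where
    movable : Compressible U V X → PositionView X movable
    image : ¬ Compressible U V X → Compressible V U X → PositionView X image
    fixed : ¬ Compressible U V X → ¬ Compressible V U X → PositionView X fixed

  position-view : ∀ X → PositionView X (position X)
  position-view X with compressible? U V X | compressible? V U X
  ... | yes c | _ = movable c
  ... | no ¬c | yes c′ = image ¬c c′
  ... | no ¬c | no ¬c′ = fixed ¬c ¬c′

  position-movable⁻ : ∀ X → position X ≡ movable → Compressible U V X
  position-movable⁻ X eq with position X | position-view X
  ... | movable | movable c = c

  position-image⁻ : ∀ X → position X ≡ image → Compressible V U X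
  position-image⁻ X eq with position X | position-view X
  ... | image | image _ c = c

  position-fixed⁻ : ∀ X → position X ≡ fixed → ¬ Compressible U V X
  position-fixed⁻ X eq with position X | position-view X
  ... | fixed | fixed ¬c _ = ¬c

  position-movable : ∀ X → Compressible U V X → position X ≡ movable
  position-movable X c with compressible? U V X
  ... | yes _ = refl
  ... | no ¬c = contradiction c ¬c

  position-image : ∀ X → ¬ Compressible U V X → Compressible V U X → position X ≡ image
  position-image X ¬c c′ with compressible? U V X | compressible? V U X
  ... | yes c | _ = contradiction c ¬c
  ... | no _ | yes _ = refl
  ... | no _ | no ¬c′ = contradiction c′ ¬c′

  partner : Position → Subset n → Subset n
  partner movable X = compress U V X
  partner image X = compress V U X
  partner fixed X = X

  τ : Subset n → Subset n
  τ X = partner (position X) X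

  σ : Tuple n d → Tuple n d
  σ A = A [ j ]≔ τ (lookup A j)

  -- Of a pair {A, σ A} with A movable, only σ A survives when just one of them lies in G.
  compressFamily : Family n d → Family n d
  compressFamily G A = combine (position (lookup A j)) (G A) (G (σ A))

  τ-movable : ∀ X → position X ≡ movable → τ X ≡ compress U V X
  τ-movable X eq rewrite eq = refl

  τ-image : ∀ X → position X ≡ image → τ X ≡ compress V U X
  τ-image X eq rewrite eq = refl

  lookup-σ : ∀ A → lookup (σ A) j ≡ τ (lookup A j)
  lookup-σ A = Vec.lookup∘update j A _


  V∩U≡∅ : Disjoint V U
  V∩U≡∅ = Disjoint-sym U V disjoint

  image⇒¬movable : ∀ X → Compressible V U X → ¬ Compressible U V X
  image⇒¬movable X (_ , V∩X≡∅) (V⊆X , _) =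
    contradiction (trans (sym (V⊆X top top∈V)) (V∩X≡∅ top top∈V)) true≢false

  position-compress-movable : ∀ X → Compressible U V X → position (compress U V X) ≡ image
  position-compress-movable X c = position-image (compress U V X) (image⇒¬movable (compress U V X) c′) c′
    where c′ = compress-compressible U V disjoint X c

  position-compress-image : ∀ X → Compressible V U X → position (compress V U X) ≡ movable
  position-compress-image X c = position-movable (compress V U X) (compress-compressible V U V∩U≡∅ X c)

  τ-compressible-image : ∀ X → Compressible V U X → τ X ≡ compress V U X
  τ-compressible-image X c = τ-image X (position-image X (image⇒¬movable X c) c)

  τ-involutive : ∀ X → τ (τ X) ≡ X
  τ-involutive X with position X in eq | position-view X
  ... | movable | movable c rewrite position-compress-movable X c = compress-involutive U V disjoint X c
  ... | image | image _ c rewrite position-compress-image X c = compress-involutive V U V∩U≡∅ X c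
  ... | fixed | fixed _ _ rewrite eq = refl

  σ-involutive : ∀ A → σ (σ A) ≡ A
  σ-involutive A = begin
    σ A [ j ]≔ τ (lookup (σ A) j) ≡⟨ cong (λ Y → σ A [ j ]≔ τ Y) (lookup-σ A) ⟩
    σ A [ j ]≔ τ (τ (lookup A j)) ≡⟨ Vec.[]≔-idempotent A j ⟩
    A [ j ]≔ τ (τ (lookup A j))   ≡⟨ cong (A [ j ]≔_) (τ-involutive (lookup A j)) ⟩
    A [ j ]≔ lookup A j           ≡⟨ Vec.[]≔-lookup A j ⟩
    A                             ∎
    where open ≡-Reasoning

  compress-<colex : ∀ X → Compressible U V X → compress U V X <colex X
  compress-<colex X (V⊆X , _) = top , V⊆X top top∈V , top∉compress , agree
    where
    top∉compress : lookup (compress U V X) top ≡ false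
    top∉compress rewrite lookup-compress U V X top | top∈V | Bool.∧-zeroʳ (lookup X top) =
      V∩U≡∅ top top∈V
    agree : ∀ k → top <ᶠ k → lookup (compress U V X) k ≡ lookup X k
    agree k top<k rewrite lookup-compress U V X k | proj₁ (aboveTop k top<k) | proj₂ (aboveTop k top<k) =
      trans (Bool.∨-identityʳ _) (Bool.∧-identityʳ _)

  position-σ-movable : ∀ A → position (lookup A j) ≡ movable → position (lookup (σ A) j) ≡ image
  position-σ-movable A eq rewrite lookup-σ A | eq =
    position-compress-movable (lookup A j) (position-movable⁻ (lookup A j) eq)

  position-σ-image : ∀ A → position (lookup A j) ≡ image → position (lookup (σ A) j) ≡ movable
  position-σ-image A eq rewrite lookup-σ A | eq =
    position-compress-image (lookup A j) (position-image⁻ (lookup A j) eq)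

  weight-σ-movable : ∀ A → position (lookup A j) ≡ movable → weight (σ A) < weight A
  weight-σ-movable A eq rewrite eq = weight-[]≔-< A j _
    (colex⇒value< (compress U V (lookup A j)) (lookup A j)
      (compress-<colex (lookup A j) (position-movable⁻ (lookup A j) eq)))

  data Orbit (A : Tuple n d) : Set where
    down : position (lookup A j) ≡ movable → position (lookup (σ A) j) ≡ image →
           weight (σ A) < weight A → Orbit A
    up : position (lookup A j) ≡ image → position (lookup (σ A) j) ≡ movable →
         weight A < weight (σ A) → Orbit A
    still : position (lookup A j) ≡ fixed → position (lookup (σ A) j) ≡ fixed → Orbit A

  orbit : ∀ A → Orbit A
  orbit A with position (lookup A j) in eq
  ... | movable = down eq (position-σ-movable A eq) (weight-σ-movable A eq)
  ... | image = up eq (position-σ-image A eq) (subst (λ B → weight B < weight (σ A)) (σ-involutive A)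
                         (weight-σ-movable (σ A) (position-σ-image A eq)))
  ... | fixed = still eq (trans (cong (λ B → position (lookup B j)) σA≡A) eq)
    where
    σA≡A : σ A ≡ A
    σA≡A rewrite eq = Vec.[]≔-lookup A j

  compressFamily-σ : ∀ G A → compressFamily G (σ A) ≡ combine (position (lookup (σ A) j)) (G (σ A)) (G A)
  compressFamily-σ G A = cong (combine (position (lookup (σ A) j)) (G (σ A))) (cong G (σ-involutive A))

  orbit-count : ∀ G A → ⟦ compressFamily G A ⟧ + ⟦ compressFamily G (σ A) ⟧ ≡ ⟦ G A ⟧ + ⟦ G (σ A) ⟧
  orbit-count G A = trans (cong (λ b → ⟦ compressFamily G A ⟧ + ⟦ b ⟧) (compressFamily-σ G A)) (by (orbit A))
    where
    by : Orbit A → ⟦ compressFamily G A ⟧ + ⟦ combine (position (lookup (σ A) j)) (G (σ A)) (G A) ⟧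
                   ≡ ⟦ G A ⟧ + ⟦ G (σ A) ⟧
    by (down p p′ _) = combine-count-down p p′ (G A) (G (σ A))
    by (up p p′ _) = combine-count-up p p′ (G A) (G (σ A))
    by (still p p′) = combine-count-fixed p p′ (G A) (G (σ A))

  card-compressFamily : ∀ G → card (compressFamily G) ≡ card G
  card-compressFamily G = begin
    card (compressFamily G)         ≡⟨ card-∑ (compressFamily G) ⟩
    ∑ (⟦_⟧ ∘ compressFamily G)      ≡⟨ ∑-orbitwise-≡ σ σ-involutive _ _ (orbit-count G) ⟩
    ∑ (⟦_⟧ ∘ G)                     ≡⟨ card-∑ G ⟨
    card G                          ∎
    where open ≡-Reasoning

  orbit-weight : ∀ G A → ⟦ compressFamily G A ⟧ * weight A + ⟦ compressFamily G (σ A) ⟧ * weight (σ A)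
                       ≤ ⟦ G A ⟧ * weight A + ⟦ G (σ A) ⟧ * weight (σ A)
  orbit-weight G A = subst (λ b → ⟦ compressFamily G A ⟧ * weight A + ⟦ b ⟧ * weight (σ A) ≤ before)
                           (sym (compressFamily-σ G A)) (by (orbit A))
    where
    before = ⟦ G A ⟧ * weight A + ⟦ G (σ A) ⟧ * weight (σ A)
    by : Orbit A → ⟦ compressFamily G A ⟧ * weight A +
                   ⟦ combine (position (lookup (σ A) j)) (G (σ A)) (G A) ⟧ * weight (σ A) ≤ before
    by (down p p′ lt) = combine-weight-down p p′ (G A) (G (σ A)) (ℕ.<⇒≤ lt)
    by (up p p′ lt) = combine-weight-up p p′ (G A) (G (σ A)) (ℕ.<⇒≤ lt)
    by (still p p′) = combine-weight-fixed p p′ (G A) (G (σ A))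

  totalWeight-compressFamily-< : ∀ G A → position (lookup A j) ≡ movable → G A ≡ true → G (σ A) ≡ false →
    totalWeight (compressFamily G) < totalWeight G
  totalWeight-compressFamily-< G A movableA GA GσA = ∑-orbitwise-< σ σ-involutive _ _ (orbit-weight G) A
    (subst (λ b → ⟦ compressFamily G A ⟧ * weight A + ⟦ b ⟧ * weight (σ A) < before) (sym (compressFamily-σ G A))
      (combine-weight-strict movableA (position-σ-movable A movableA) GA GσA (weight-σ-movable A movableA)))
    where before = ⟦ G A ⟧ * weight A + ⟦ G (σ A) ⟧ * weight (σ A)

  τ-size : ∀ X → ∣ τ X ∣ ≡ ∣ X ∣
  τ-size X with position X | position-view X
  ... | movable | movable c = compress-size U V X c sameSize
  ... | image | image _ c = compress-size V U X c (sym sameSize)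
  ... | fixed | fixed _ _ = refl

  compressFamily-IsFamilyOf : ∀ {r} G → IsFamilyOf r G → IsFamilyOf r (compressFamily G)
  compressFamily-IsFamilyOf {r} G G⊆ A CGA with combine-true (position (lookup A j)) (G A) (G (σ A)) CGA
  ... | inj₁ GA = G⊆ A GA
  ... | inj₂ GσA = subst (AllSize r) (σ-involutive A) (AllSize-[]≔ (σ A) j _ (G⊆ (σ A) GσA)
    (trans (τ-size (lookup (σ A) j)) (lookup-[]≔-size (σ A) j (G⊆ (σ A) GσA))))

-- The shadow

open Equivalence using (to; from)

IsTupleDeletion : ∀ {n d} → Tuple n d → Tuple n d → Set
IsTupleDeletion {d = d} A B = ∀ (i : Fin d) → IsDeletion (lookup A i) (lookup B i)

InShadow : ∀ {n d} → Family n d → Tuple n d → Set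
InShadow {n} {d} G B = Σ (Tuple n d) λ A → G A ≡ true × IsTupleDeletion A B

isDeletion-sound : ∀ {n} (S T : Subset n) → isDeletion S T ≡ true → IsDeletion S T
isDeletion-sound {n} S T e with satisfied (any⁻ _ (allFin n) (from T-≡ e))
... | x , t with to T-∧ t
...   | Sx , T≡S-x = x , to T-≡ Sx , toWitness T≡S-x

isDeletion-complete : ∀ {n} (S T : Subset n) → IsDeletion S T → isDeletion S T ≡ true
isDeletion-complete S T (x , Sx , T≡S-x) =
  to T-≡ (any⁺ _ (lose (∈-allFin x) (from T-∧ (from T-≡ Sx , fromWitness T≡S-x))))

isTupleDeletion-sound : ∀ {n d} (A B : Tuple n d) → isTupleDeletion A B ≡ true → IsTupleDeletion A B
isTupleDeletion-sound (S ∷ A) (T ∷ B) e zero = isDeletion-sound S T (Bool.∧-conicalˡ _ _ e)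
isTupleDeletion-sound (S ∷ A) (T ∷ B) e (suc i) = isTupleDeletion-sound A B (Bool.∧-conicalʳ _ _ e) i

isTupleDeletion-complete : ∀ {n d} (A B : Tuple n d) → IsTupleDeletion A B → isTupleDeletion A B ≡ true
isTupleDeletion-complete [] [] _ = refl
isTupleDeletion-complete (S ∷ A) (T ∷ B) del
  rewrite isDeletion-complete S T (del zero) = isTupleDeletion-complete A B (del ∘ suc)

shadow-sound : ∀ {n d} (G : Family n d) B → shadow G B ≡ true → InShadow G B
shadow-sound {n} {d} G B e with satisfied (any⁻ _ (allTuples n d) (from T-≡ e))
... | A , t with to T-∧ t
...   | GA , A⇝B = A , to T-≡ GA , isTupleDeletion-sound A B (to T-≡ A⇝B)

shadow-complete : ∀ {n d} (G : Family n d) B → InShadow G B → shadow G B ≡ true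
shadow-complete {n} {d} G B (A , GA , A⇝B) = to T-≡ (any⁺ _ (lose (allTuples-complete n d A)
  (from T-∧ (from T-≡ GA , from T-≡ (isTupleDeletion-complete A B A⇝B)))))

shadow-false : ∀ {n d} (G : Family n d) B → ¬ InShadow G B → shadow G B ≡ false
shadow-false G B ∉∂G with shadow G B in e
... | true = contradiction (shadow-sound G B e) ∉∂G
... | false = refl

tupleDeletion-[]≔ : ∀ {n d} (A B : Tuple n d) j {X Y} → IsTupleDeletion A B → IsDeletion X Y →
  IsTupleDeletion (A [ j ]≔ X) (B [ j ]≔ Y)
tupleDeletion-[]≔ A B j {X} {Y} A⇝B X⇝Y i with i Fin.≟ j
... | yes refl = subst₂ IsDeletion (sym (Vec.lookup∘update i A X)) (sym (Vec.lookup∘update i B Y)) X⇝Y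
... | no i≢j =
  subst₂ IsDeletion (sym (Vec.lookup∘update′ i≢j A X)) (sym (Vec.lookup∘update′ i≢j B Y)) (A⇝B i)

combine-false : ∀ P b → combine P false b ≡ true → P ≡ image × b ≡ true
combine-false image b e = refl , e

module _ {n d : ℕ} (j : Fin d) {U V : Subset n} (pair : CompressionPair U V) where
  open Compression j pair
  open CompressionPair pair

  -- The Kruskal–Katona condition under which compression does not enlarge the shadow.
  ShrinkCompressed : Family n d → Set
  ShrinkCompressed G = ∀ u → lookup U u ≡ true → Σ (Fin n) λ v → lookup V v ≡ true × Compressed j (U - u) (V - v) G

  module _ (G : Family n d) (shrink : ShrinkCompressed G) where

    private
      C = compressFamily G

    ∂C∖∂G⇒image : ∀ B → InShadow C B → ¬ InShadow G B → Compressible V U (lookup B j) × InShadow G (σ B)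
    ∂C∖∂G⇒image B (A , CA , A⇝B) B∉∂G with G A in GA
    ... | true = contradiction (A , GA , A⇝B) B∉∂G
    ... | false = Bj-image , σ A , GσA , σA⇝σB
      where
      X = lookup A j
      A-image : position X ≡ image
      A-image = proj₁ (combine-false (position X) (G (σ A)) CA)
      GσA : G (σ A) ≡ true
      GσA = proj₂ (combine-false (position X) (G (σ A)) CA)
      X-image : Compressible V U X
      X-image = position-image⁻ X A-image
      σAj : lookup (σ A) j ≡ compress V U X
      σAj = trans (lookup-σ A) (τ-image X A-image)
      x = proj₁ (A⇝B j)
      Xx : lookup X x ≡ true
      Xx = proj₁ (proj₂ (A⇝B j))
      Bj≡X-x : lookup B j ≡ X - x
      Bj≡X-x = proj₂ (proj₂ (A⇝B j))

      x∉U : lookup U x ≡ false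
      x∉U with lookup U x in Ux
      ... | false = refl
      ... | true with shrink x Ux
      ...   | v , Vv , compressed with shrink-del-preimage U V disjoint X x v Ux Vv X-image
      ...     | c , del = contradiction (A [ j ]≔ Z , GZ , A[j≔Z]⇝B) B∉∂G
        where
        Z = compress (U - x) (V - v) (compress V U X)
        GZ : G (A [ j ]≔ Z) ≡ true
        GZ = subst (λ A′ → G A′ ≡ true)
          (trans (cong (λ W → σ A [ j ]≔ compress (U - x) (V - v) W) σAj) (Vec.[]≔-idempotent A j))
          (compressed (σ A) (subst (Compressible (U - x) (V - v)) (sym σAj) c) GσA)
        A[j≔Z]⇝B : IsTupleDeletion (A [ j ]≔ Z) B
        A[j≔Z]⇝B = subst (IsTupleDeletion (A [ j ]≔ Z)) (Vec.[]≔-lookup B j)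
          (tupleDeletion-[]≔ A B j A⇝B (subst (IsDeletion Z) (sym Bj≡X-x) del))

      Bj-image : Compressible V U (lookup B j)
      Bj-image = subst (Compressible V U) (sym Bj≡X-x) (del-compressible V U X x x∉U X-image)

      σA⇝σB : IsTupleDeletion (σ A) (σ B)
      σA⇝σB = tupleDeletion-[]≔ A B j A⇝B
        (subst₂ IsDeletion (sym (τ-image X A-image))
                (sym (trans (τ-compressible-image (lookup B j) Bj-image) (cong (compress V U) Bj≡X-x)))
                (compress-del V U X x Xx x∉U X-image))

    image∖∂G⇒σ∉∂C : ∀ B → Compressible V U (lookup B j) → ¬ InShadow G B → ¬ InShadow C (σ B)
    image∖∂G⇒σ∉∂C B Bj-image B∉∂G (A , CA , A⇝σB) = by-position (position Y) refl
      where
      Y = lookup A j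
      y = proj₁ (A⇝σB j)
      open ParentOfImage U V disjoint (lookup B j) Y y Bj-image (proj₁ (proj₂ (A⇝σB j)))
        (trans (sym (trans (lookup-σ B) (τ-compressible-image (lookup B j) Bj-image)))
               (proj₂ (proj₂ (A⇝σB j))))
      parent⇝B : ∀ {Z} → IsDeletion Z (lookup B j) → IsTupleDeletion (A [ j ]≔ Z) B
      parent⇝B {Z} del = subst (IsTupleDeletion (A [ j ]≔ Z)) restore (tupleDeletion-[]≔ A (σ B) j A⇝σB del)
        where
        restore : σ B [ j ]≔ lookup B j ≡ B
        restore = trans (Vec.[]≔-idempotent B j) (Vec.[]≔-lookup B j)
      CA′ : ∀ {P} → position Y ≡ P → combine P (G A) (G (σ A)) ≡ true
      CA′ eq = subst (λ P → combine P (G A) (G (σ A)) ≡ true) eq CA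
      by-position : ∀ P → position Y ≡ P → ⊥
      by-position image eq =
        true≢false (trans (sym (V⊆Y top top∈V)) (proj₂ (position-image⁻ Y eq) top top∈V))
      by-position movable eq = B∉∂G (σ A , Bool.∧-conicalʳ _ _ (CA′ eq) , parent⇝B
        (subst (λ Z → IsDeletion Z (lookup B j)) (sym (τ-movable Y eq))
               (compressible⇒del (position-movable⁻ Y eq))))
      by-position fixed eq with incompressible⇒∈U (position-fixed⁻ Y eq)
      ... | Uy with shrink y Uy
      ...   | v , Vv , compressed with shrink-del v Uy Vv
      ...     | c , del = B∉∂G (A [ j ]≔ compress (U - y) (V - v) Y , compressed A c (CA′ eq) , parent⇝B del)

    card-shadow-compressFamily : card (shadow C) ≤ card (shadow G)
    card-shadow-compressFamily = card-≤-by-involution σ σ-involutive (shadow C) (shadow G) shift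
      where
      shift : ∀ B → shadow C B ≡ true → shadow G B ≡ false → shadow G (σ B) ≡ true × shadow C (σ B) ≡ false
      shift B B∈∂C B∉∂G = shadow-complete G (σ B) (proj₂ imageB) ,
                          shadow-false C (σ B) (image∖∂G⇒σ∉∂C B (proj₁ imageB) ¬B∈∂G)
        where
        ¬B∈∂G : ¬ InShadow G B
        ¬B∈∂G B∈∂G = true≢false (trans (sym (shadow-complete G B B∈∂G)) B∉∂G)
        imageB = ∂C∖∂G⇒image B (shadow-sound C B B∈∂C) ¬B∈∂G

-- Compressing until the family is monotone

module _ {X : Set} (xs : List X) (complete : ∀ x → x ∈ xs) where

  ∃-complete? : ∀ {P : X → Set} → Decidable P → Dec (Σ X P)
  ∃-complete? P? = map′ satisfied (λ (x , px) → lose (complete x) px) (Any.any? P? xs)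

  ∀-complete? : ∀ {P : X → Set} → Decidable P → Dec (∀ x → P x)
  ∀-complete? P? =
    map′ (λ all x → All.lookup all (complete x)) (λ p → All.tabulate λ {x} _ → p x) (All.all? P? xs)

  ¬∀⇒∃¬ : ∀ {P : X → Set} → Decidable P → ¬ (∀ x → P x) → Σ X (¬_ ∘ P)
  ¬∀⇒∃¬ {P} P? ¬∀ with ∃-complete? {P = ¬_ ∘ P} (¬? ∘ P?)
  ... | yes ∃¬ = ∃¬
  ... | no ¬∃¬ = contradiction (λ x → decidable-stable (P? x) (λ ¬Px → ¬∃¬ (x , ¬Px))) ¬∀

minimal-witness : ∀ {X : Set} {P : X → Set} (μ : X → ℕ) → (∀ s → Dec (Σ X λ x → P x × μ x < s)) →
  Σ X P → Σ X λ x → P x × (∀ y → μ y < μ x → ¬ P y)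
minimal-witness {X = X} {P} μ smaller? (x , px) = below (μ x) x px ℕ.≤-refl
  where
  below : ∀ s x → P x → μ x ≤ s → Σ X λ x → P x × (∀ y → μ y < μ x → ¬ P y)
  below s x px μx≤s with smaller? (μ x)
  ... | no none = x , px , λ y μy<μx py → none (y , py , μy<μx)
  below zero x px μx≤0 | yes (y , py , μy<μx) = contradiction (ℕ.<-≤-trans μy<μx μx≤0) ℕ.n≮0
  below (suc s) x px μx≤s | yes (y , py , μy<μx) = below s y py (ℕ.≤-pred (ℕ.<-≤-trans μy<μx μx≤s))

compressionPair? : ∀ {n} (U V : Subset n) → Dec (CompressionPair U V)
compressionPair? U V = map′ (λ (d , s , t , t∈V , above) → record
    { disjoint = d ; sameSize = s ; top = t ; top∈V = t∈V ; aboveTop = above })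
  (λ p → let open CompressionPair p in disjoint , sameSize , top , top∈V , aboveTop)
  (disjoint? U V ×-dec (∣ U ∣ ℕ.≟ ∣ V ∣) ×-dec Fin.any? λ t → (lookup V t ≟ true) ×-dec
    Fin.all? λ k → (t <ᶠ? k) →-dec ((lookup U k ≟ false) ×-dec (lookup V k ≟ false)))

module _ {n d : ℕ} (j : Fin d) (U V : Subset n) (G : Family n d) where

  private
    CompressesAt : Tuple n d → Set
    CompressesAt A = Compressible U V (lookup A j) → G A ≡ true → G (A [ j ]≔ compress U V (lookup A j)) ≡ true

    compressesAt? : ∀ A → Dec (CompressesAt A)
    compressesAt? A = compressible? U V (lookup A j) →-dec (G A ≟ true) →-dec
                        (G (A [ j ]≔ compress U V (lookup A j)) ≟ true)

  compressed? : Dec (Compressed j U V G)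
  compressed? = ∀-complete? (allTuples n d) (allTuples-complete n d) compressesAt?

  ¬compressed⇒witness : ¬ Compressed j U V G →
    Σ (Tuple n d) λ A →
      Compressible U V (lookup A j) × G A ≡ true × G (A [ j ]≔ compress U V (lookup A j)) ≡ false
  ¬compressed⇒witness ¬c with ¬∀⇒∃¬ (allTuples n d) (allTuples-complete n d) compressesAt? ¬c
  ... | A , ¬compressesAt with compressible? U V (lookup A j) | G A ≟ true
  ...   | no ¬c′ | _ = contradiction (λ c′ → contradiction c′ ¬c′) ¬compressesAt
  ...   | yes _ | no ¬GA = contradiction (λ _ GA → contradiction GA ¬GA) ¬compressesAt
  ...   | yes c′ | yes GA with G (A [ j ]≔ compress U V (lookup A j)) in GZ
  ...     | true = contradiction (λ _ _ → refl) ¬compressesAt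
  ...     | false = A , c′ , GA , GZ

Compressed-∅ : ∀ {n d} j (U V : Subset n) (G : Family n d) →
  (∀ k → lookup U k ≡ false) → (∀ k → lookup V k ≡ false) → Compressed j U V G
Compressed-∅ j U V G U≡∅ V≡∅ A _ GA = subst (λ A′ → G A′ ≡ true)
  (sym (trans (cong (A [ j ]≔_) (compress-∅ U V (lookup A j) U≡∅ V≡∅)) (Vec.[]≔-lookup A j))) GA

CompressedBelow : ∀ {n d} → Family n d → ℕ → Set
CompressedBelow {n} {d} G s = ∀ j (U V : Subset n) → CompressionPair U V → ∣ U ∣ < s → Compressed j U V G

module _ {n} {U V : Subset n} (pair : CompressionPair U V) where
  open CompressionPair pair

  ∣del∣-sameSize : ∀ {u v} → lookup U u ≡ true → lookup V v ≡ true → ∣ U - u ∣ ≡ ∣ V - v ∣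
  ∣del∣-sameSize {u} {v} Uu Vv = ℕ.suc-injective (trans (∣del∣ U u Uu) (trans sameSize (sym (∣del∣ V v Vv))))

  shrink-pair : ∀ {u v} → lookup U u ≡ true → lookup V v ≡ true → top ≢ v → CompressionPair (U - u) (V - v)
  shrink-pair {u} {v} Uu Vv top≢v = record
    { disjoint = λ k e → lookup-del-false V v (disjoint k (del-⊆ˢ U u k e))
    ; sameSize = ∣del∣-sameSize Uu Vv
    ; top = top
    ; top∈V = trans (lookup-del-other V top≢v) top∈V
    ; aboveTop = λ k top<k → lookup-del-false U u (proj₁ (aboveTop k top<k)) ,
                             lookup-del-false V v (proj₂ (aboveTop k top<k))
    }

  -- v is taken from V - top, so that top survives and (U - u, V - v) is again a compression
  -- pair; when |U| = 1 both shrunken sets are empty.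
  shrinkCompressed : ∀ {d} j (G : Family n d) → CompressedBelow G ∣ U ∣ → ShrinkCompressed j pair G
  shrinkCompressed j G below u Uu with ∣ U - u ∣ in e
  ... | zero = top , top∈V , Compressed-∅ j (U - u) (V - top) G (∣∣≡0⇒empty (U - u) e)
                                (∣∣≡0⇒empty (V - top) (trans (sym (∣del∣-sameSize Uu top∈V)) e))
  ... | suc m with ∣∣≡suc⇒nonempty (V - top) (trans (sym (∣del∣-sameSize Uu top∈V)) e)
  ...   | v , v∈V-top = v , del-⊆ˢ V top v v∈V-top ,
          below j (U - u) (V - v) (shrink-pair Uu (del-⊆ˢ V top v v∈V-top) top≢v)
                (ℕ.≤-reflexive (∣del∣ U u Uu))
    where
    top≢v : top ≢ v
    top≢v refl = true≢false (trans (sym v∈V-top) (lookup-del-same V top))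

module _ {n : ℕ} where

  _∖_ : Subset n → Subset n → Subset n
  A ∖ B = tabulate λ k → lookup A k ∧ not (lookup B k)

  lookup-∖ : ∀ A B k → lookup (A ∖ B) k ≡ lookup A k ∧ not (lookup B k)
  lookup-∖ A B = Vec.lookup∘tabulate _

  ∖-sameSize : ∀ A B → ∣ A ∣ ≡ ∣ B ∣ → ∣ A ∖ B ∣ ≡ ∣ B ∖ A ∣
  ∖-sameSize A B ∣A∣≡∣B∣ = ℕ.+-cancelʳ-≡ (∣ A ∣) _ _
    (trans (cong (∣ A ∖ B ∣ +_) ∣A∣≡∣B∣) (∣∣-+-pointwise (A ∖ B) B (B ∖ A) A pointwise))
    where
    pointwise : ∀ k → ⟦ lookup (A ∖ B) k ⟧ + ⟦ lookup B k ⟧ ≡ ⟦ lookup (B ∖ A) k ⟧ + ⟦ lookup A k ⟧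
    pointwise k rewrite lookup-∖ A B k | lookup-∖ B A k with lookup A k | lookup B k
    ... | true | true = refl
    ... | true | false = refl
    ... | false | true = refl
    ... | false | false = refl

  colex-pair : ∀ A B → ∣ A ∣ ≡ ∣ B ∣ → A <colex B → CompressionPair (A ∖ B) (B ∖ A)
  colex-pair A B ∣A∣≡∣B∣ (i , Bi , Ai , agree) = record
    { disjoint = disjoint
    ; sameSize = ∖-sameSize A B ∣A∣≡∣B∣
    ; top = i
    ; top∈V = trans (lookup-∖ B A i) (cong₂ (λ b a → b ∧ not a) Bi Ai)
    ; aboveTop = aboveTop
    }
    where
    disjoint : Disjoint (A ∖ B) (B ∖ A)
    disjoint k e rewrite lookup-∖ A B k | lookup-∖ B A k with lookup A k | lookup B k | e
    ... | true | false | _ = refl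
    aboveTop : ∀ k → i <ᶠ k → lookup (A ∖ B) k ≡ false × lookup (B ∖ A) k ≡ false
    aboveTop k i<k rewrite lookup-∖ A B k | lookup-∖ B A k | agree k i<k with lookup B k
    ... | true = refl , refl
    ... | false = refl , refl

  ∖-compressible : ∀ A B → Compressible (A ∖ B) (B ∖ A) B
  ∖-compressible A B = B∖A⊆B , A∖B∩B≡∅
    where
    B∖A⊆B : (B ∖ A) ⊆ˢ B
    B∖A⊆B k e rewrite lookup-∖ B A k with lookup B k | e
    ... | true | _ = refl
    A∖B∩B≡∅ : Disjoint (A ∖ B) B
    A∖B∩B≡∅ k e rewrite lookup-∖ A B k with lookup A k | lookup B k | e
    ... | true | false | _ = refl

  compress-∖ : ∀ A B → compress (A ∖ B) (B ∖ A) B ≡ A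
  compress-∖ A B = lookup-ext _ _ λ k → begin
    lookup (compress (A ∖ B) (B ∖ A) B) k
      ≡⟨ lookup-compress (A ∖ B) (B ∖ A) B k ⟩
    (lookup B k ∧ not (lookup (B ∖ A) k)) ∨ lookup (A ∖ B) k
      ≡⟨ cong₂ (λ ba ab → (lookup B k ∧ not ba) ∨ ab) (lookup-∖ B A k) (lookup-∖ A B k) ⟩
    (lookup B k ∧ not (lookup B k ∧ not (lookup A k))) ∨ (lookup A k ∧ not (lookup B k))
      ≡⟨ boolean (lookup A k) (lookup B k) ⟩
    lookup A k ∎
    where
    open ≡-Reasoning
    boolean : ∀ a b → (b ∧ not (b ∧ not a)) ∨ (a ∧ not b) ≡ a
    boolean true true = refl
    boolean true false = refl
    boolean false true = refl
    boolean false false = refl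

allCompressed⇒Monotone : ∀ {n d r} (G : Family n d) → IsFamilyOf r G →
  (∀ j (U V : Subset n) → CompressionPair U V → Compressed j U V G) → Monotone r G
allCompressed⇒Monotone {r = r} G G⊆ compressed j S A B ∣A∣≡r A<B GT =
  subst (λ T → G T ≡ true) T[j≔A]≡S[j≔A]
    (compressed j (A ∖ B) (B ∖ A) (colex-pair A B (trans ∣A∣≡r (sym ∣B∣≡r)) A<B) T
      (subst (Compressible (A ∖ B) (B ∖ A)) (sym Tj≡B) (∖-compressible A B)) GT)
  where
  T = S [ j ]≔ B
  Tj≡B : lookup T j ≡ B
  Tj≡B = Vec.lookup∘update j S B
  ∣B∣≡r : ∣ B ∣ ≡ r
  ∣B∣≡r = subst (λ X → ∣ X ∣ ≡ r) Tj≡B (lookup-[]≔-size T j (G⊆ T GT))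
  T[j≔A]≡S[j≔A] : T [ j ]≔ compress (A ∖ B) (B ∖ A) (lookup T j) ≡ S [ j ]≔ A
  T[j≔A]≡S[j≔A] = trans (cong (λ X → T [ j ]≔ compress (A ∖ B) (B ∖ A) X) Tj≡B)
                        (trans (Vec.[]≔-idempotent S j) (cong (S [ j ]≔_) (compress-∖ A B)))

Triple : ℕ → ℕ → Set
Triple n d = Fin d × Subset n × Subset n

Uncompressed : ∀ {n d} → Family n d → Triple n d → Set
Uncompressed G (j , U , V) = CompressionPair U V × ¬ Compressed j U V G

uncompressed? : ∀ {n d} (G : Family n d) t → Dec (Uncompressed G t)
uncompressed? G (j , U , V) = compressionPair? U V ×-dec ¬? (compressed? j U V G)

∃-triple? : ∀ {n d} {P : Triple n d → Set} → Decidable P → Dec (Σ (Triple n d) P)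
∃-triple? P? = map′ (λ (j , U , V , p) → (j , U , V) , p) (λ ((j , U , V) , p) → j , U , V , p)
  (Fin.any? λ j → anySubset? λ U → anySubset? λ V → P? (j , U , V))

minimalUncompressed : ∀ {n d} (G : Family n d) → Σ (Triple n d) (Uncompressed G) →
  Σ (Triple n d) λ (j , U , V) → Uncompressed G (j , U , V) × CompressedBelow G ∣ U ∣
minimalUncompressed G bad with minimal-witness size smaller? bad
  where
  size = λ ((_ , U , _) : Triple _ _) → ∣ U ∣
  smaller? = λ s → ∃-triple? λ t → uncompressed? G t ×-dec (size t ℕ.<? s)
... | t , uncompressed , minimal = t , uncompressed , λ j U V pair lt →
  decidable-stable (compressed? j U V G) λ ¬c → minimal (j , U , V) lt (pair , ¬c)

LighterReplacement : ∀ {n d} → ℕ → Family n d → Set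
LighterReplacement {n} {d} r G = Σ (Family n d) λ G′ →
  IsFamilyOf r G′ × card G′ ≡ card G × card (shadow G′) ≤ card (shadow G) × totalWeight G′ < totalWeight G

MonotoneReplacement : ∀ {n d} → ℕ → Family n d → Set
MonotoneReplacement {n} {d} r F = Σ (Family n d) λ F₀ →
  IsFamilyOf r F₀ × Monotone r F₀ × card F₀ ≡ card F × card (shadow F₀) ≤ card (shadow F)

compressionStep : ∀ {n d r} (G : Family n d) → IsFamilyOf r G → Σ (Triple n d) (Uncompressed G) →
  LighterReplacement r G
compressionStep G G⊆ bad with minimalUncompressed G bad
... | (j , U , V) , (pair , ¬compressed) , below with ¬compressed⇒witness j U V G ¬compressed
...   | A , c , GA , GZ =
  compressFamily G , compressFamily-IsFamilyOf G G⊆ , card-compressFamily G ,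
  card-shadow-compressFamily j pair G (shrinkCompressed pair j G below) ,
  totalWeight-compressFamily-< G A movableA GA
    (subst (λ Z → G (A [ j ]≔ Z) ≡ false) (sym (τ-movable (lookup A j) movableA)) GZ)
  where
  open Compression j pair
  movableA = position-movable (lookup A j) c

MonotoneReplacement-trans : ∀ {n d r} {F G : Family n d} → card G ≡ card F → card (shadow G) ≤ card (shadow F) →
  MonotoneReplacement r G → MonotoneReplacement r F
MonotoneReplacement-trans card≡ shadow≤ (F₀ , F₀⊆ , monotone , card₀≡ , shadow₀≤) =
  F₀ , F₀⊆ , monotone , trans card₀≡ card≡ , ℕ.≤-trans shadow₀≤ shadow≤

compressToMonotone : ∀ {n d r} (F : Family n d) → IsFamilyOf r F → MonotoneReplacement r F
compressToMonotone F F⊆ = go F F⊆ (On.wellFounded totalWeight <-wellFounded F)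
  where
  go : ∀ {n d r} (G : Family n d) → IsFamilyOf r G → Acc (_<_ on totalWeight) G → MonotoneReplacement r G
  go {n} {d} {r} G G⊆ (acc smaller) = byCases (∃-triple? (uncompressed? G))
    where
    continue : LighterReplacement r G → MonotoneReplacement r G
    continue (G′ , G′⊆ , card≡ , shadow≤ , lighter) =
      MonotoneReplacement-trans card≡ shadow≤ (go G′ G′⊆ (smaller lighter))
    byCases : Dec (Σ (Triple n d) (Uncompressed G)) → MonotoneReplacement r G
    byCases (yes bad) = continue (compressionStep G G⊆ bad)
    byCases (no none) = G , G⊆ , allCompressed⇒Monotone G G⊆ compressed , refl , ℕ.≤-refl
      where
      compressed : ∀ j U V → CompressionPair U V → Compressed j U V G
      compressed j U V pair = decidable-stable (compressed? j U V G) λ ¬c → none ((j , U , V) , pair , ¬c)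

lemma1 : (n r d : ℕ) → 1 ≤ n → 1 ≤ r → 1 ≤ d →
    (F : Family n d) → IsFamilyOf r F →
    Σ (Family n d) λ F₀ →
      IsFamilyOf r F₀ × Monotone r F₀ ×
      (card F₀ ≡ card F) × (card (shadow F₀) ≤ card (shadow F))
lemma1 n r d _ _ _ = compressToMonotone
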